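{- The following two sets of transformations are maximal simplifications from inside: $r_1$: $\neg \neg (\neg \neg A \wedge \neg \neg B) \Rightarrow \neg \neg (A \wedge B)$; $\neg \neg (\neg \neg A \vee \neg \neg B) \Rightarrow \neg \neg (A \vee B)$; $\neg \neg (\neg \neg A \to \neg \neg B) \Rightarrow \neg \neg (A \to B)$; $\neg\neg \exists x \neg \neg A \Rightarrow \neg \neg \exists x A$. $r_2$: $\neg \neg ( \neg A \wedge \neg B) \Rightarrow \neg ( A \vee B)$; $\neg \neg ( \neg A \vee \neg B) \Rightarrow \neg (A \wedge B)$; $\neg \neg (\neg A \to \neg B) \Rightarrow \neg (\neg A \wedge B)$; $\neg \neg \forall x \neg A \Rightarrow \neg \exists x A$.
   Context: Work in first-order logic with primitives $\bot,\top,\wedge,\vee,\to,\forall,\exists$; $\neg C$ abbreviates $C\to\bot$; ${\sf IL}$ is intuitionistic logic. In transformations, $A,B$ are schematic formula variables and $x$ a variable. A "negation" below means a (possibly empty, where indicated) finite string of $\neg$ symbols. A simplification from inside is a set of transformations, at most one for each of the symbols $\wedge,\vee,\to,\forall,\exists$, each of the form $\neg \neg (N A \,\square\, N B) \Rightarrow N (N_1 A \;\square^{r}\, N_2 B)$ (for the connective $\square$) or $\neg\neg Q x N A \Rightarrow N (Q^{r} x N_1 A)$ (for the quantifier $Q$), where $\square, \square^{r} \in \{\wedge, \vee, \to\}$, $Q, Q^{r} \in \{\forall, \exists\}$, $N$ is either a single negation $\neg$ or a double negation $\neg\neg$ (the same choice for all transformations of the set), and $N_1$, $N_2$ are strings of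 negations (possibly empty, not necessarily the same in different transformations), such that for each transformation (i) the two sides are equivalent in ${\sf IL}$ for all formulas $A,B$, and (ii) the number of negation symbols on the right side is strictly less than on the left side. A simplification (from inside) is maximal if (i) it is not properly included in any other simplification (from inside), i.e. adding transformations for further connectives or quantifiers prevents the set from being a simplification, and (ii) it is not possible to replace $\square^r$, $Q^r$, $N_1$, $N_2$ in any of its transformations so as to reduce the number of negations on the right side of that transformation while remaining a simplification. -}

module Defs where

open import Data.Nat using (ℕ; zero; suc; _+_; _<_)
open import Data.List using (List; []; _∷_; map)
open import Data.List.Membership.Propositional using (_∈_)
open import Data.Maybe using (Maybe; just; nothing)
open import Data.Product using (_×_; _,_)
open import Relation.Binary.PropositionalEquality using (_≡_; refl)
open import Relation.Nullary using (¬_; Dec; yes; no)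

data Term : Set where
  var : ℕ → Term
  fun : ℕ → List Term → Term

data Formula : Set where
  atom       : ℕ → List Term → Formula
  ⊥' ⊤'      : Formula
  _∧'_ _∨'_ _⇒_ : Formula → Formula → Formula
  ∀' ∃'      : Formula → Formula   -- binds de Bruijn index 0

infixr 6 _∧'_
infixr 5 _∨'_
infixr 4 _⇒_

¬' : Formula → Formula
¬' C = C ⇒ ⊥'

neg : ℕ → Formula → Formula
neg zero    A = A
neg (suc n) A = ¬' (neg n A)

Subst : Set
Subst = ℕ → Term

mutual
  substT : Subst → Term → Term
  substT σ (var n)    = σ n
  substT σ (fun f ts) = fun f (substTs σ ts)

  substTs : Subst → List Term → List Term
  substTs σ []       = []
  substTs σ (t ∷ ts) = substT σ t ∷ substTs σ ts

exts : Subst → Subst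
exts σ zero    = var zero
exts σ (suc n) = substT (λ m → var (suc m)) (σ n)

substF : Subst → Formula → Formula
substF σ (atom p ts) = atom p (substTs σ ts)
substF σ ⊥'          = ⊥'
substF σ ⊤'          = ⊤'
substF σ (A ∧' B)    = substF σ A ∧' substF σ B
substF σ (A ∨' B)    = substF σ A ∨' substF σ B
substF σ (A ⇒ B)     = substF σ A ⇒ substF σ B
substF σ (∀' A)      = ∀' (substF (exts σ) A)
substF σ (∃' A)      = ∃' (substF (exts σ) A)

shift : Formula → Formula
shift = substF (λ m → var (suc m))

inst0 : Term → Subst
inst0 t zero    = t
inst0 t (suc n) = var n

_[_] : Formula → Term → Formula
A [ t ] = substF (inst0 t) A

infix 2 _⊢_

data _⊢_ (Γ : List Formula) : Formula → Set where
  ax   : ∀ {A} → A ∈ Γ → Γ ⊢ A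
  ⊤I   : Γ ⊢ ⊤'
  ⊥E   : ∀ {A} → Γ ⊢ ⊥' → Γ ⊢ A
  ∧I   : ∀ {A B} → Γ ⊢ A → Γ ⊢ B → Γ ⊢ A ∧' B
  ∧E₁  : ∀ {A B} → Γ ⊢ A ∧' B → Γ ⊢ A
  ∧E₂  : ∀ {A B} → Γ ⊢ A ∧' B → Γ ⊢ B
  ∨I₁  : ∀ {A B} → Γ ⊢ A → Γ ⊢ A ∨' B
  ∨I₂  : ∀ {A B} → Γ ⊢ B → Γ ⊢ A ∨' B
  ∨E   : ∀ {A B C} → Γ ⊢ A ∨' B → (A ∷ Γ) ⊢ C → (B ∷ Γ) ⊢ C → Γ ⊢ C
  ⇒I   : ∀ {A B} → (A ∷ Γ) ⊢ B → Γ ⊢ A ⇒ B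
  ⇒E   : ∀ {A B} → Γ ⊢ A ⇒ B → Γ ⊢ A → Γ ⊢ B
  ∀I   : ∀ {A} → map shift Γ ⊢ A → Γ ⊢ ∀' A
  ∀E   : ∀ {A} → Γ ⊢ ∀' A → (t : Term) → Γ ⊢ A [ t ]
  ∃I   : ∀ {A} (t : Term) → Γ ⊢ A [ t ] → Γ ⊢ ∃' A
  ∃E   : ∀ {A C} → Γ ⊢ ∃' A → (A ∷ map shift Γ) ⊢ shift C → Γ ⊢ C

_≣IL_ : Formula → Formula → Set
A ≣IL B = ([] ⊢ A ⇒ B) × ([] ⊢ B ⇒ A)

data Con : Set where
  cand cor cimp : Con

data Qu : Set where
  qall qex : Qu

data Sym : Set where
  con : Con → Sym
  qu  : Qu → Sym

conOp : Con → Formula → Formula → Formula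
conOp cand A B = A ∧' B
conOp cor  A B = A ∨' B
conOp cimp A B = A ⇒ B

quOp : Qu → Formula → Formula
quOp qall A = ∀' A
quOp qex  A = ∃' A

data NegN : Set where
  single double : NegN

#N : NegN → ℕ
#N single = 1
#N double = 2

-- data of the right-hand side: (□ʳ, N₁, N₂) for a connective,
-- (Qʳ, N₁) for a quantifier (negation strings given by their length)
Rhs : Sym → Set
Rhs (con _) = Con × ℕ × ℕ
Rhs (qu _)  = Qu × ℕ

record Trans (σ : Sym) : Set where
  constructor trans
  field
    N   : NegN
    rhs : Rhs σ
open Trans public

LHS : (σ : Sym) → NegN → Formula → Formula → Formula
LHS (con c) N A B = neg 2 (conOp c (neg (#N N) A) (neg (#N N) B))
LHS (qu q)  N A B = neg 2 (quOp q (neg (#N N) A))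

RHS : (σ : Sym) → NegN → Rhs σ → Formula → Formula → Formula
RHS (con c) N (c' , n₁ , n₂) A B = neg (#N N) (conOp c' (neg n₁ A) (neg n₂ B))
RHS (qu q)  N (q' , n₁)      A B = neg (#N N) (quOp q' (neg n₁ A))

lhsCount : Sym → NegN → ℕ
lhsCount (con _) N = 2 + #N N + #N N
lhsCount (qu _)  N = 2 + #N N

rhsCount : (σ : Sym) → NegN → Rhs σ → ℕ
rhsCount (con _) N (_ , n₁ , n₂) = #N N + n₁ + n₂
rhsCount (qu _)  N (_ , n₁)      = #N N + n₁

-- conditions (i) and (ii) for a single transformation
-- (for quantifiers the formula B is simply unused)
Valid : (σ : Sym) → Trans σ → Set
Valid σ t =
  ((A B : Formula) → LHS σ (N t) A B ≣IL RHS σ (N t) (rhs t) A B)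
  × (rhsCount σ (N t) (rhs t) < lhsCount σ (N t))

TSet : Set
TSet = (σ : Sym) → Maybe (Trans σ)

Simplification : TSet → Set
Simplification S =
  ((σ : Sym) (t : Trans σ) → S σ ≡ just t → Valid σ t)
  × ((σ τ : Sym) (t : Trans σ) (u : Trans τ) →
       S σ ≡ just t → S τ ≡ just u → N t ≡ N u)

_⊆T_ : TSet → TSet → Set
S ⊆T S' = (σ : Sym) (t : Trans σ) → S σ ≡ just t → S' σ ≡ just t

_≟S_ : (σ τ : Sym) → Dec (σ ≡ τ)
con cand ≟S con cand = yes refl
con cor  ≟S con cor  = yes refl
con cimp ≟S con cimp = yes refl
qu qall  ≟S qu qall  = yes refl
qu qex   ≟S qu qex   = yes refl
con cand ≟S con cor  = no λ ()
con cand ≟S con cimp = no λ ()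
con cor  ≟S con cand = no λ ()
con cor  ≟S con cimp = no λ ()
con cimp ≟S con cand = no λ ()
con cimp ≟S con cor  = no λ ()
qu qall  ≟S qu qex   = no λ ()
qu qex   ≟S qu qall  = no λ ()
con _    ≟S qu _     = no λ ()
qu _     ≟S con _    = no λ ()

update : TSet → (σ : Sym) → Maybe (Trans σ) → TSet
update S σ m τ with σ ≟S τ
... | yes refl = m
... | no _     = S τ

Maximal : TSet → Set
Maximal S =
  Simplification S
  -- (i) not properly included in any other simplification
  × ((S' : TSet) → Simplification S' → S ⊆T S' → S' ⊆T S)
  × ((σ : Sym) (t : Trans σ) → S σ ≡ just t → (r : Rhs σ) →
       Simplification (update S σ (just (trans (N t) r))) →
       ¬ (rhsCount σ (N t) r < rhsCount σ (N t) (rhs t)))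

-- r₁ : ¬¬(¬¬A ∧ ¬¬B) ⇒ ¬¬(A ∧ B);  ¬¬(¬¬A ∨ ¬¬B) ⇒ ¬¬(A ∨ B);
--      ¬¬(¬¬A → ¬¬B) ⇒ ¬¬(A → B);  ¬¬∃x¬¬A ⇒ ¬¬∃xA
r₁ : TSet
r₁ (con cand) = just (trans double (cand , 0 , 0))
r₁ (con cor)  = just (trans double (cor  , 0 , 0))
r₁ (con cimp) = just (trans double (cimp , 0 , 0))
r₁ (qu qall)  = nothing
r₁ (qu qex)   = just (trans double (qex , 0))

-- r₂ : ¬¬(¬A ∧ ¬B) ⇒ ¬(A ∨ B);  ¬¬(¬A ∨ ¬B) ⇒ ¬(A ∧ B);
--      ¬¬(¬A → ¬B) ⇒ ¬(¬A ∧ B);  ¬¬∀x¬A ⇒ ¬∃xA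
r₂ : TSet
r₂ (con cand) = just (trans single (cor  , 0 , 0))
r₂ (con cor)  = just (trans single (cand , 0 , 0))
r₂ (con cimp) = just (trans single (cand , 1 , 0))
r₂ (qu qall)  = just (trans single (qex , 0))
r₂ (qu qex)   = nothing

-- Maximality of a set S of transformations has three parts.
--   * S is a simplification: each transformation of S is an IL-equivalence
--     (checked by explicit natural-deduction derivations, organised around
--     the double-negation "monad" ¬¬-unit / ¬¬-bind) and removes negations.
--   * S cannot be extended: the only symbol missing from S (∀ for r₁,
--     ∃ for r₂) admits no valid transformation with the N of S.  Since the
--     number of negations must drop, only finitely many right sides remain,
--     and each is refuted by a countermodel.
--   * No right side can be shortened: every right side of r₁, and all but
--     one of r₂, already has the least conceivable count #N; the remaining
--     one (for →) is shortened only to schemata refuted by countermodels.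
-- Countermodels come from the soundness of IL for constant-domain Kripke
-- models, proved here for arbitrary such models; the model actually used
-- has worlds and individuals ℕ, an atom P₀ x that becomes true at stage x
-- and an atom P₁ x that holds only of 0.

module Submission where

open import Defs
open import Data.Empty using (⊥; ⊥-elim)
open import Data.List using (List; []; _∷_; map)
open import Data.List.Relation.Binary.Subset.Propositional using (_⊆_)
open import Data.List.Relation.Binary.Subset.Propositional.Properties using (∷⁺ʳ; map⁺; xs⊆x∷xs)
open import Data.List.Relation.Unary.All as All using (All; []; _∷_)
open import Data.List.Relation.Unary.All.Properties as All using ()
open import Data.List.Relation.Unary.Any using (here; there)
open import Data.Maybe using (Maybe; just; nothing)
open import Data.Maybe.Properties using (just-injective)
open import Data.Nat using (ℕ; zero; suc; _+_; _≤_; _<_; s≤s)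
open import Data.Nat.Properties using (≤-refl; ≤-trans; m≤m+n; m≤n+m; <ᵇ⇒<; ≤⇒≯; 1+n≰n)
open import Data.Product using (Σ; _×_; _,_; proj₁; proj₂)
open import Data.Sum using (_⊎_; inj₁; inj₂; [_,_])
open import Data.Unit using (⊤; tt)
open import Relation.Binary.PropositionalEquality
  using (_≡_; _≗_; refl; sym; cong; cong₂; subst; module ≡-Reasoning)
  renaming (trans to ≡-trans)
open import Relation.Nullary using (¬_; yes; no)

↑ : Subst
↑ n = var (suc n)

mutual
  substT-∘ : ∀ ρ τ t → substT ρ (substT τ t) ≡ substT (λ n → substT ρ (τ n)) t
  substT-∘ ρ τ (var n)    = refl
  substT-∘ ρ τ (fun f ts) = cong (fun f) (substTs-∘ ρ τ ts)

  substTs-∘ : ∀ ρ τ ts → substTs ρ (substTs τ ts) ≡ substTs (λ n → substT ρ (τ n)) ts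
  substTs-∘ ρ τ []       = refl
  substTs-∘ ρ τ (t ∷ ts) = cong₂ _∷_ (substT-∘ ρ τ t) (substTs-∘ ρ τ ts)

_Undoes_ : Subst → Subst → Set
τ Undoes σ = ∀ n → substT τ (σ n) ≡ var n

mutual
  substT-undo : ∀ {σ τ} → τ Undoes σ → ∀ t → substT τ (substT σ t) ≡ t
  substT-undo h (var n)    = h n
  substT-undo h (fun f ts) = cong (fun f) (substTs-undo h ts)

  substTs-undo : ∀ {σ τ} → τ Undoes σ → ∀ ts → substTs τ (substTs σ ts) ≡ ts
  substTs-undo h []       = refl
  substTs-undo h (t ∷ ts) = cong₂ _∷_ (substT-undo h t) (substTs-undo h ts)

exts-undo : ∀ {σ τ} → τ Undoes σ → exts τ Undoes exts σ
exts-undo h zero = refl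
exts-undo {σ} {τ} h (suc n) = begin
  substT (exts τ) (substT ↑ (σ n))        ≡⟨ substT-∘ (exts τ) ↑ (σ n) ⟩
  substT (λ m → substT ↑ (τ m)) (σ n)     ≡⟨ sym (substT-∘ ↑ τ (σ n)) ⟩
  substT ↑ (substT τ (σ n))               ≡⟨ cong (substT ↑) (h n) ⟩
  var (suc n)                             ∎
  where open ≡-Reasoning

substF-undo : ∀ {σ τ} → τ Undoes σ → ∀ A → substF τ (substF σ A) ≡ A
substF-undo h (atom p ts) = cong (atom p) (substTs-undo h ts)
substF-undo h ⊥'          = refl
substF-undo h ⊤'          = refl
substF-undo h (A ∧' B)    = cong₂ _∧'_ (substF-undo h A) (substF-undo h B)
substF-undo h (A ∨' B)    = cong₂ _∨'_ (substF-undo h A) (substF-undo h B)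
substF-undo h (A ⇒ B)     = cong₂ _⇒_ (substF-undo h A) (substF-undo h B)
substF-undo h (∀' A)      = cong ∀' (substF-undo (exts-undo h) A)
substF-undo h (∃' A)      = cong ∃' (substF-undo (exts-undo h) A)

-- This is what lets a
-- hypothesis ∀x A or ∃x A, weakened by ∀I/∃E, be used at the same A.
instantiate-lifted : ∀ A → substF (exts ↑) A [ var 0 ] ≡ A
instantiate-lifted = substF-undo undo
  where
  undo : inst0 (var 0) Undoes exts ↑
  undo zero    = refl
  undo (suc n) = refl

weaken : ∀ {Γ Δ A} → Γ ⊆ Δ → Γ ⊢ A → Δ ⊢ A
weaken s (ax i)     = ax (s i)
weaken s ⊤I         = ⊤I
weaken s (⊥E p)     = ⊥E (weaken s p)
weaken s (∧I p q)   = ∧I (weaken s p) (weaken s q)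
weaken s (∧E₁ p)    = ∧E₁ (weaken s p)
weaken s (∧E₂ p)    = ∧E₂ (weaken s p)
weaken s (∨I₁ p)    = ∨I₁ (weaken s p)
weaken s (∨I₂ p)    = ∨I₂ (weaken s p)
weaken s (∨E p q r) = ∨E (weaken s p) (weaken (∷⁺ʳ _ s) q) (weaken (∷⁺ʳ _ s) r)
weaken s (⇒I p)     = ⇒I (weaken (∷⁺ʳ _ s) p)
weaken s (⇒E p q)   = ⇒E (weaken s p) (weaken s q)
weaken s (∀I p)     = ∀I (weaken (map⁺ shift s) p)
weaken s (∀E p t)   = ∀E (weaken s p) t
weaken s (∃I t p)   = ∃I t (weaken s p)
weaken s (∃E p q)   = ∃E (weaken s p) (weaken (∷⁺ʳ _ (map⁺ shift s)) q)

weaken₁ : ∀ {Γ A B} → Γ ⊢ A → (B ∷ Γ) ⊢ A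
weaken₁ {Γ} {B = B} = weaken (xs⊆x∷xs Γ B)

v0 : ∀ {Γ A} → (A ∷ Γ) ⊢ A
v0 = ax (here refl)
v1 : ∀ {Γ A B} → (B ∷ A ∷ Γ) ⊢ A
v1 = ax (there (here refl))
v2 : ∀ {Γ A B C} → (C ∷ B ∷ A ∷ Γ) ⊢ A
v2 = ax (there (there (here refl)))
v3 : ∀ {Γ A B C D} → (D ∷ C ∷ B ∷ A ∷ Γ) ⊢ A
v3 = ax (there (there (there (here refl))))

-- ¬¬ is a monad for negated goals: A gives ¬¬A, and to prove ¬C from ¬¬A
-- one may assume A.
¬¬-unit : ∀ {Γ A} → Γ ⊢ A → Γ ⊢ neg 2 A
¬¬-unit p = ⇒I (⇒E v0 (weaken₁ p))

¬¬-bind : ∀ {Γ A C} → Γ ⊢ neg 2 A → (A ∷ Γ) ⊢ ¬' C → Γ ⊢ ¬' C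
¬¬-bind {Γ} {A} {C} p k = ⇒I (⇒E (weaken₁ p) (⇒I (⇒E (weaken skipC k) v1)))
  where
  skipC : (A ∷ Γ) ⊆ (A ∷ C ∷ Γ)
  skipC = ∷⁺ʳ A (xs⊆x∷xs Γ C)

lift-intro : ∀ {Γ} A → Γ ⊢ A → Γ ⊢ substF (exts ↑) A [ var 0 ]
lift-intro {Γ} A = subst (Γ ⊢_) (sym (instantiate-lifted A))

lift-elim : ∀ {Γ} A → Γ ⊢ substF (exts ↑) A [ var 0 ] → Γ ⊢ A
lift-elim {Γ} A = subst (Γ ⊢_) (instantiate-lifted A)

record KripkeModel : Set₁ where
  field
    World      : Set
    _≼_        : World → World → Set
    ≼-refl     : ∀ {w} → w ≼ w
    ≼-trans    : ∀ {u v w} → u ≼ v → v ≼ w → u ≼ w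
    Dom        : Set
    funI       : ℕ → List Dom → Dom
    atomI      : World → ℕ → List Dom → Set
    atomI-mono : ∀ {w w'} p ds → w ≼ w' → atomI w p ds → atomI w' p ds

module Forcing (M : KripkeModel) where
  open KripkeModel M

  Env : Set
  Env = ℕ → Dom

  _∷ₑ_ : Dom → Env → Env
  (d ∷ₑ ρ) zero    = d
  (d ∷ₑ ρ) (suc n) = ρ n

  infixr 5 _∷ₑ_

  mutual
    evT : Env → Term → Dom
    evT ρ (var n)    = ρ n
    evT ρ (fun f ts) = funI f (evTs ρ ts)

    evTs : Env → List Term → List Dom
    evTs ρ []       = []
    evTs ρ (t ∷ ts) = evT ρ t ∷ evTs ρ ts

  infix 3 _∣_⊩_

  _∣_⊩_ : World → Env → Formula → Set
  w ∣ ρ ⊩ atom p ts = atomI w p (evTs ρ ts)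
  w ∣ ρ ⊩ ⊥'        = ⊥
  w ∣ ρ ⊩ ⊤'        = ⊤
  w ∣ ρ ⊩ A ∧' B    = w ∣ ρ ⊩ A × w ∣ ρ ⊩ B
  w ∣ ρ ⊩ A ∨' B    = w ∣ ρ ⊩ A ⊎ w ∣ ρ ⊩ B
  w ∣ ρ ⊩ A ⇒ B     = ∀ w' → w ≼ w' → w' ∣ ρ ⊩ A → w' ∣ ρ ⊩ B
  w ∣ ρ ⊩ ∀' A      = ∀ d → w ∣ d ∷ₑ ρ ⊩ A
  w ∣ ρ ⊩ ∃' A      = Σ Dom λ d → w ∣ d ∷ₑ ρ ⊩ A

  ⊩-mono : ∀ A {w w' ρ} → w ≼ w' → w ∣ ρ ⊩ A → w' ∣ ρ ⊩ A
  ⊩-mono (atom p ts) {ρ = ρ} le a = atomI-mono p (evTs ρ ts) le a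
  ⊩-mono ⊥'       le ()
  ⊩-mono ⊤'       le a        = a
  ⊩-mono (A ∧' B) le (a , b)  = ⊩-mono A le a , ⊩-mono B le b
  ⊩-mono (A ∨' B) le (inj₁ a) = inj₁ (⊩-mono A le a)
  ⊩-mono (A ∨' B) le (inj₂ b) = inj₂ (⊩-mono B le b)
  ⊩-mono (A ⇒ B)  le f        = λ w'' le' → f w'' (≼-trans le le')
  ⊩-mono (∀' A)   le f        = λ d → ⊩-mono A le (f d)
  ⊩-mono (∃' A)   le (d , a)  = d , ⊩-mono A le a

  ∷ₑ-cong : ∀ {ρ ρ'} d → ρ ≗ ρ' → (d ∷ₑ ρ) ≗ (d ∷ₑ ρ')
  ∷ₑ-cong d e zero    = refl
  ∷ₑ-cong d e (suc n) = e n

  mutual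
    evT-cong : ∀ {ρ ρ'} → ρ ≗ ρ' → ∀ t → evT ρ t ≡ evT ρ' t
    evT-cong e (var n)    = e n
    evT-cong e (fun f ts) = cong (funI f) (evTs-cong e ts)

    evTs-cong : ∀ {ρ ρ'} → ρ ≗ ρ' → ∀ ts → evTs ρ ts ≡ evTs ρ' ts
    evTs-cong e []       = refl
    evTs-cong e (t ∷ ts) = cong₂ _∷_ (evT-cong e t) (evTs-cong e ts)

  ⊩-cong : ∀ A {w ρ ρ'} → ρ ≗ ρ' → w ∣ ρ ⊩ A → w ∣ ρ' ⊩ A
  ⊩-cong (atom p ts) {w} e a = subst (atomI w p) (evTs-cong e ts) a
  ⊩-cong ⊥'       e ()
  ⊩-cong ⊤'       e a        = a
  ⊩-cong (A ∧' B) e (a , b)  = ⊩-cong A e a , ⊩-cong B e b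
  ⊩-cong (A ∨' B) e (inj₁ a) = inj₁ (⊩-cong A e a)
  ⊩-cong (A ∨' B) e (inj₂ b) = inj₂ (⊩-cong B e b)
  ⊩-cong (A ⇒ B)  e f        = λ w' le a → ⊩-cong B e (f w' le (⊩-cong A (λ n → sym (e n)) a))
  ⊩-cong (∀' A)   e f        = λ d → ⊩-cong A (∷ₑ-cong d e) (f d)
  ⊩-cong (∃' A)   e (d , a)  = d , ⊩-cong A (∷ₑ-cong d e) a

  _⊙_ : Env → Subst → Env
  (ρ ⊙ σ) n = evT ρ (σ n)

  mutual
    evT-subst : ∀ ρ σ t → evT ρ (substT σ t) ≡ evT (ρ ⊙ σ) t
    evT-subst ρ σ (var n)    = refl
    evT-subst ρ σ (fun f ts) = cong (funI f) (evTs-subst ρ σ ts)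

    evTs-subst : ∀ ρ σ ts → evTs ρ (substTs σ ts) ≡ evTs (ρ ⊙ σ) ts
    evTs-subst ρ σ []       = refl
    evTs-subst ρ σ (t ∷ ts) = cong₂ _∷_ (evT-subst ρ σ t) (evTs-subst ρ σ ts)

  ⊙-exts : ∀ ρ σ d → ((d ∷ₑ ρ) ⊙ exts σ) ≗ (d ∷ₑ (ρ ⊙ σ))
  ⊙-exts ρ σ d zero    = refl
  ⊙-exts ρ σ d (suc n) = evT-subst (d ∷ₑ ρ) ↑ (σ n)

  mutual
    ⊩-subst⁺ : ∀ A σ {w ρ} → w ∣ ρ ⊩ substF σ A → w ∣ ρ ⊙ σ ⊩ A
    ⊩-subst⁺ (atom p ts) σ {w} {ρ} a = subst (atomI w p) (evTs-subst ρ σ ts) a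
    ⊩-subst⁺ ⊥'       σ ()
    ⊩-subst⁺ ⊤'       σ a        = a
    ⊩-subst⁺ (A ∧' B) σ (a , b)  = ⊩-subst⁺ A σ a , ⊩-subst⁺ B σ b
    ⊩-subst⁺ (A ∨' B) σ (inj₁ a) = inj₁ (⊩-subst⁺ A σ a)
    ⊩-subst⁺ (A ∨' B) σ (inj₂ b) = inj₂ (⊩-subst⁺ B σ b)
    ⊩-subst⁺ (A ⇒ B)  σ f        = λ w' le a → ⊩-subst⁺ B σ (f w' le (⊩-subst⁻ A σ a))
    ⊩-subst⁺ (∀' A) σ {ρ = ρ} f       = λ d → ⊩-cong A (⊙-exts ρ σ d) (⊩-subst⁺ A (exts σ) (f d))
    ⊩-subst⁺ (∃' A) σ {ρ = ρ} (d , a) = d , ⊩-cong A (⊙-exts ρ σ d) (⊩-subst⁺ A (exts σ) a)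

    ⊩-subst⁻ : ∀ A σ {w ρ} → w ∣ ρ ⊙ σ ⊩ A → w ∣ ρ ⊩ substF σ A
    ⊩-subst⁻ (atom p ts) σ {w} {ρ} a = subst (atomI w p) (sym (evTs-subst ρ σ ts)) a
    ⊩-subst⁻ ⊥'       σ ()
    ⊩-subst⁻ ⊤'       σ a        = a
    ⊩-subst⁻ (A ∧' B) σ (a , b)  = ⊩-subst⁻ A σ a , ⊩-subst⁻ B σ b
    ⊩-subst⁻ (A ∨' B) σ (inj₁ a) = inj₁ (⊩-subst⁻ A σ a)
    ⊩-subst⁻ (A ∨' B) σ (inj₂ b) = inj₂ (⊩-subst⁻ B σ b)
    ⊩-subst⁻ (A ⇒ B)  σ f        = λ w' le a → ⊩-subst⁻ B σ (f w' le (⊩-subst⁺ A σ a))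
    ⊩-subst⁻ (∀' A) σ {ρ = ρ} f =
      λ d → ⊩-subst⁻ A (exts σ) (⊩-cong A (λ n → sym (⊙-exts ρ σ d n)) (f d))
    ⊩-subst⁻ (∃' A) σ {ρ = ρ} (d , a) =
      d , ⊩-subst⁻ A (exts σ) (⊩-cong A (λ n → sym (⊙-exts ρ σ d n)) a)

  ∷ₑ-inst0 : ∀ ρ t → (evT ρ t ∷ₑ ρ) ≗ (ρ ⊙ inst0 t)
  ∷ₑ-inst0 ρ t zero    = refl
  ∷ₑ-inst0 ρ t (suc n) = refl

  _∣_⊩*_ : World → Env → List Formula → Set
  w ∣ ρ ⊩* Γ = All (λ B → w ∣ ρ ⊩ B) Γ

  ⊩*-mono : ∀ {Γ w w' ρ} → w ≼ w' → w ∣ ρ ⊩* Γ → w' ∣ ρ ⊩* Γ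
  ⊩*-mono le = All.map (λ {B} → ⊩-mono B le)

  ⊩*-shift : ∀ {Γ w ρ} d → w ∣ ρ ⊩* Γ → w ∣ d ∷ₑ ρ ⊩* map shift Γ
  ⊩*-shift d c = All.map⁺ (All.map (λ {B} → ⊩-subst⁻ B ↑) c)

  sound : ∀ {Γ A} → Γ ⊢ A → ∀ w ρ → w ∣ ρ ⊩* Γ → w ∣ ρ ⊩ A
  sound (ax i)     w ρ c = All.lookup c i
  sound ⊤I         w ρ c = tt
  sound (⊥E p)     w ρ c = ⊥-elim (sound p w ρ c)
  sound (∧I p q)   w ρ c = sound p w ρ c , sound q w ρ c
  sound (∧E₁ p)    w ρ c = proj₁ (sound p w ρ c)
  sound (∧E₂ p)    w ρ c = proj₂ (sound p w ρ c)
  sound (∨I₁ p)    w ρ c = inj₁ (sound p w ρ c)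
  sound (∨I₂ p)    w ρ c = inj₂ (sound p w ρ c)
  sound (∨E p q r) w ρ c =
    [ (λ a → sound q w ρ (a ∷ c)) , (λ b → sound r w ρ (b ∷ c)) ] (sound p w ρ c)
  sound (⇒I p)     w ρ c = λ w' le a → sound p w' ρ (a ∷ ⊩*-mono le c)
  sound (⇒E p q)   w ρ c = sound p w ρ c w ≼-refl (sound q w ρ c)
  sound (∀I p)     w ρ c = λ d → sound p w (d ∷ₑ ρ) (⊩*-shift d c)
  sound (∀E {A} p t) w ρ c =
    ⊩-subst⁻ A (inst0 t) (⊩-cong A (∷ₑ-inst0 ρ t) (sound p w ρ c (evT ρ t)))
  sound (∃I {A} t p) w ρ c =
    evT ρ t , ⊩-cong A (λ n → sym (∷ₑ-inst0 ρ t n)) (⊩-subst⁺ A (inst0 t) (sound p w ρ c))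
  sound (∃E {A} {C} p q) w ρ c with sound p w ρ c
  ... | d , a = ⊩-subst⁺ C ↑ (sound q w (d ∷ₑ ρ) (a ∷ ⊩*-shift d c))

  countermodel : ∀ {X Y} w ρ → w ∣ ρ ⊩ X → ¬ (w ∣ ρ ⊩ Y) → ¬ ([] ⊢ X ⇒ Y)
  countermodel w ρ x ¬y d = ¬y (sound d w ρ [] w ≼-refl x)

  -- Forcing of (double) negations.  The environment is explicit: for the
  -- closed formulas used below it is not determined by the forcing type.
  ¬-intro : ∀ X {w} ρ → (∀ w' → w ≼ w' → ¬ (w' ∣ ρ ⊩ X)) → w ∣ ρ ⊩ ¬' X
  ¬-intro X ρ never w' le x = ⊥-elim (never w' le x)

  ¬-refuted : ∀ X {w} ρ → w ∣ ρ ⊩ X → ¬ (w ∣ ρ ⊩ ¬' X)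
  ¬-refuted X ρ x n = n _ ≼-refl x

  ¬¬-intro : ∀ X {w} ρ → w ∣ ρ ⊩ X → w ∣ ρ ⊩ neg 2 X
  ¬¬-intro X ρ x w' le k = k w' ≼-refl (⊩-mono X le x)

  ¬¬-never : ∀ X {w} ρ → (∀ w' → w ≼ w' → ¬ (w' ∣ ρ ⊩ X)) → ¬ (w ∣ ρ ⊩ neg 2 X)
  ¬¬-never X ρ never nn = nn _ ≼-refl (¬-intro X ρ never)

-- The countermodel: worlds ℕ, individuals ℕ, function symbols denoting 0,
-- atom 0 (written P₀) true of d from world d on, every other unary atom
-- (P₁) true of 0 only, and nullary atoms false.

growing : ℕ → ℕ → List ℕ → Set
growing w zero    (d ∷ _) = d ≤ w
growing w (suc _) (d ∷ _) = d ≡ 0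
growing w _       []      = ⊥

growing-mono : ∀ {w w'} p ds → w ≤ w' → growing w p ds → growing w' p ds
growing-mono zero    (d ∷ _) le a = ≤-trans a le
growing-mono (suc _) (d ∷ _) le a = a
growing-mono zero    []      le ()
growing-mono (suc _) []      le ()

ℕ-model : KripkeModel
ℕ-model = record
  { World      = ℕ
  ; _≼_        = _≤_
  ; ≼-refl     = ≤-refl
  ; ≼-trans    = ≤-trans
  ; Dom        = ℕ
  ; funI       = λ _ _ → 0
  ; atomI      = growing
  ; atomI-mono = growing-mono
  }

open Forcing ℕ-model

P₀ P₁ : Formula
P₀ = atom 0 (var 0 ∷ [])
P₁ = atom 1 (var 0 ∷ [])

ρ₀ : Env
ρ₀ _ = 0

-- each instance of P₀ is eventually true, so ¬¬P₀ holds everywhere ...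
¬¬P₀ : ∀ {w} ρ d → w ∣ d ∷ₑ ρ ⊩ neg 2 P₀
¬¬P₀ ρ d w' le k = k (d + w') (m≤n+m w' d) (m≤m+n d w')

¬P₀-never : ∀ {w} ρ d → ¬ (w ∣ d ∷ₑ ρ ⊩ ¬' P₀)
¬P₀-never ρ d n = ¬¬P₀ ρ d _ ≤-refl n

∀P₀-never : ∀ {w} ρ → ¬ (w ∣ ρ ⊩ ∀' P₀)
∀P₀-never {w} ρ all = 1+n≰n (all (suc w))

P₁-zero : ∀ {w} ρ → w ∣ 0 ∷ₑ ρ ⊩ P₁
P₁-zero ρ = refl

P₁-one-never : ∀ {w} ρ → ¬ (w ∣ 1 ∷ₑ ρ ⊩ P₁)
P₁-one-never ρ ()

¬⊤-never : ∀ {w} ρ → ¬ (w ∣ ρ ⊩ ¬' ⊤')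
¬⊤-never ρ = ¬-refuted ⊤' ρ tt

¬⊥-forced : ∀ {w} ρ → w ∣ ρ ⊩ ¬' ⊥'
¬⊥-forced ρ = ¬-intro ⊥' ρ (λ _ _ b → b)

¬¬∀¬¬⊤-forced : ∀ {w} ρ → w ∣ ρ ⊩ neg 2 (∀' (neg 2 ⊤'))
¬¬∀¬¬⊤-forced ρ = ¬¬-intro (∀' (neg 2 ⊤')) ρ (λ d → ¬¬-intro ⊤' (d ∷ₑ ρ) tt)

∀¬⊤-never : ∀ {w} ρ → ¬ (w ∣ ρ ⊩ ∀' (¬' ⊤'))
∀¬⊤-never ρ all = ¬⊤-never (0 ∷ₑ ρ) (all 0)

∃¬⊤-never : ∀ {w} ρ → ¬ (w ∣ ρ ⊩ ∃' (¬' ⊤'))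
∃¬⊤-never ρ (d , n) = ¬⊤-never (d ∷ₑ ρ) n

¬¬[¬⊤⇒¬⊤]-forced : ∀ {w} ρ → w ∣ ρ ⊩ neg 2 (¬' ⊤' ⇒ ¬' ⊤')
¬¬[¬⊤⇒¬⊤]-forced ρ = ¬¬-intro (¬' ⊤' ⇒ ¬' ⊤') ρ (λ _ _ n → n)

refuted : ∀ {X Y} → [] ⊢ X ⇒ Y → 0 ∣ ρ₀ ⊩ X → ¬ (0 ∣ ρ₀ ⊩ Y) → ⊥
refuted d x ¬y = countermodel 0 ρ₀ x ¬y d

module Equivalences (A B : Formula) where
  r₁-∧ : LHS (con cand) double A B ≣IL RHS (con cand) double (cand , 0 , 0) A B
  r₁-∧ = ⇒I (¬¬-bind v0 (¬¬-bind (∧E₁ v0) (¬¬-bind (∧E₂ v1) (¬¬-unit (∧I v1 v0)))))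
       , ⇒I (¬¬-bind v0 (¬¬-unit (∧I (¬¬-unit (∧E₁ v0)) (¬¬-unit (∧E₂ v0)))))

  r₁-∨ : LHS (con cor) double A B ≣IL RHS (con cor) double (cor , 0 , 0) A B
  r₁-∨ = ⇒I (¬¬-bind v0 (∨E v0 (¬¬-bind v0 (¬¬-unit (∨I₁ v0)))
                               (¬¬-bind v0 (¬¬-unit (∨I₂ v0)))))
       , ⇒I (¬¬-bind v0 (¬¬-unit (∨E v0 (∨I₁ (¬¬-unit v0)) (∨I₂ (¬¬-unit v0)))))

  -- ¬¬(¬¬A → ¬¬B) ≡ ¬¬(A → B); a refutation of A → B yields ¬¬A and ¬B
  r₁-⇒ : LHS (con cimp) double A B ≣IL RHS (con cimp) double (cimp , 0 , 0) A B
  r₁-⇒ = ⇒I (¬¬-bind v0 (⇒I (⇒E (⇒E v1 ¬¬A) ¬B)))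
       , ⇒I (¬¬-bind v0 (¬¬-unit (⇒I (¬¬-bind v0 (¬¬-unit (⇒E v2 v0))))))
    where
    ¬¬A : ∀ {Γ} → (¬' (A ⇒ B) ∷ Γ) ⊢ neg 2 A
    ¬¬A = ⇒I (⇒E v1 (⇒I (⊥E (⇒E v1 v0))))
    ¬B : ∀ {Γ} → (¬' (A ⇒ B) ∷ Γ) ⊢ ¬' B
    ¬B = ⇒I (⇒E v1 (⇒I v1))

  r₁-∃ : LHS (qu qex) double A B ≣IL RHS (qu qex) double (qex , 0) A B
  r₁-∃ = ⇒I (¬¬-bind v0 (∃E v0 (¬¬-bind v0 (¬¬-unit (∃I (var 0) (lift-intro A v0))))))
       , ⇒I (¬¬-bind v0 (¬¬-unit (∃E v0 (∃I (var 0) (¬¬-unit (lift-intro A v0))))))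

  r₂-∧ : LHS (con cand) single A B ≣IL RHS (con cand) single (cor , 0 , 0) A B
  r₂-∧ = ⇒I (¬¬-bind v0 (⇒I (∨E v0 (⇒E (∧E₁ v2) v0) (⇒E (∧E₂ v2) v0))))
       , ⇒I (¬¬-unit (∧I (⇒I (⇒E v1 (∨I₁ v0))) (⇒I (⇒E v1 (∨I₂ v0)))))

  -- ¬¬(¬A ∨ ¬B) ≡ ¬(A ∧ B); for ←, refute ¬A ∨ ¬B by refuting ¬A and ¬B
  r₂-∨ : LHS (con cor) single A B ≣IL RHS (con cor) single (cand , 0 , 0) A B
  r₂-∨ = ⇒I (¬¬-bind v0 (⇒I (∨E v1 (⇒E v0 (∧E₁ v1)) (⇒E v0 (∧E₂ v1)))))
       , ⇒I (⇒I (⇒E (⇒I (⇒E v1 (∨I₁ v0)))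
                     (⇒I (⇒E (⇒I (⇒E v2 (∨I₂ v0))) (⇒I (⇒E v3 (∧I v1 v0)))))))

  r₂-⇒ : LHS (con cimp) single A B ≣IL RHS (con cimp) single (cand , 1 , 0) A B
  r₂-⇒ = ⇒I (¬¬-bind v0 (⇒I (⇒E (⇒E v1 (∧E₁ v0)) (∧E₂ v0))))
       , ⇒I (¬¬-unit (⇒I (⇒I (⇒E v2 (∧I v1 v0)))))

  r₂-∀ : LHS (qu qall) single A B ≣IL RHS (qu qall) single (qex , 0) A B
  r₂-∀ = ⇒I (¬¬-bind v0 (⇒I (∃E v0 (⇒E (lift-elim (¬' A) (∀E v2 (var 0))) v0))))
       , ⇒I (¬¬-unit (∀I (⇒I (⇒E v1 (∃I (var 0) (lift-intro A v0))))))

open Equivalences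

no-double-∀ : (t : Trans (qu qall)) → N t ≡ double → ¬ Valid (qu qall) t
no-double-∀ (trans double (qall , 0)) refl (equiv , _) =
  refuted (proj₁ (equiv P₀ ⊤'))
    (¬¬-intro (∀' (neg 2 P₀)) ρ₀ (¬¬P₀ ρ₀))
    (¬¬-never (∀' P₀) ρ₀ (λ _ _ → ∀P₀-never ρ₀))
no-double-∀ (trans double (qall , 1)) refl (equiv , _) =
  refuted (proj₁ (equiv ⊤' ⊤'))
    (¬¬∀¬¬⊤-forced ρ₀)
    (¬¬-never (∀' (¬' ⊤')) ρ₀ (λ _ _ → ∀¬⊤-never ρ₀))
no-double-∀ (trans double (qex , 0)) refl (equiv , _) =
  refuted (proj₂ (equiv P₁ ⊤'))
    (¬¬-intro (∃' P₁) ρ₀ (0 , P₁-zero {0} ρ₀))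
    (¬¬-never (∀' (neg 2 P₁)) ρ₀
      (λ _ _ all → ¬¬-never P₁ (1 ∷ₑ ρ₀) (λ w _ → P₁-one-never {w} ρ₀) (all 1)))
no-double-∀ (trans double (qex , 1)) refl (equiv , _) =
  refuted (proj₁ (equiv ⊤' ⊤'))
    (¬¬∀¬¬⊤-forced ρ₀)
    (¬¬-never (∃' (¬' ⊤')) ρ₀ (λ _ _ → ∃¬⊤-never ρ₀))
-- two or more inner negations already make 4 on the right
no-double-∀ (trans double (_ , suc (suc _))) refl (_ , s≤s (s≤s (s≤s (s≤s ()))))

no-single-∃ : (t : Trans (qu qex)) → N t ≡ single → ¬ Valid (qu qex) t
no-single-∃ (trans single (qall , 0)) refl (equiv , _) =
  refuted (proj₂ (equiv P₀ ⊤'))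
    (¬-intro (∀' P₀) ρ₀ (λ _ _ → ∀P₀-never ρ₀))
    (¬¬-never (∃' (¬' P₀)) ρ₀ (λ _ _ (d , n) → ¬P₀-never ρ₀ d n))
no-single-∃ (trans single (qall , 1)) refl (equiv , _) =
  refuted (proj₂ (equiv ⊤' ⊤'))
    (¬-intro (∀' (¬' ⊤')) ρ₀ (λ _ _ → ∀¬⊤-never ρ₀))
    (¬¬-never (∃' (¬' ⊤')) ρ₀ (λ _ _ → ∃¬⊤-never ρ₀))
no-single-∃ (trans single (qex , 0)) refl (equiv , _) =
  refuted (proj₁ (equiv P₁ ⊤'))
    (¬¬-intro (∃' (¬' P₁)) ρ₀ (1 , ¬-intro P₁ (1 ∷ₑ ρ₀) (λ w _ → P₁-one-never {w} ρ₀)))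
    (¬-refuted (∃' P₁) ρ₀ (0 , P₁-zero {0} ρ₀))
no-single-∃ (trans single (qex , 1)) refl (equiv , _) =
  refuted (proj₁ (equiv ⊥' ⊤'))
    (¬¬-intro (∃' (¬' ⊥')) ρ₀ (0 , ¬⊥-forced (0 ∷ₑ ρ₀)))
    (¬-refuted (∃' (¬' ⊥')) ρ₀ (0 , ¬⊥-forced (0 ∷ₑ ρ₀)))
-- two or more inner negations already make 3 on the right
no-single-∃ (trans single (_ , suc (suc _))) refl (_ , s≤s (s≤s (s≤s ())))

no-short-⇒ : (c : Con) → ¬ Valid (con cimp) (trans single (c , 0 , 0))
no-short-⇒ cand (equiv , _) =
  refuted (proj₂ (equiv ⊥' ⊤'))
    (¬-intro (⊥' ∧' ⊤') ρ₀ (λ _ _ → proj₁))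
    (¬¬-never (¬' ⊥' ⇒ ¬' ⊤') ρ₀ (λ w _ f → ¬⊤-never ρ₀ (f w ≤-refl (¬⊥-forced ρ₀))))
no-short-⇒ cor (equiv , _) =
  refuted (proj₁ (equiv ⊤' ⊤'))
    (¬¬[¬⊤⇒¬⊤]-forced ρ₀)
    (¬-refuted (⊤' ∨' ⊤') ρ₀ (inj₁ tt))
no-short-⇒ cimp (equiv , _) =
  refuted (proj₁ (equiv ⊤' ⊤'))
    (¬¬[¬⊤⇒¬⊤]-forced ρ₀)
    (¬-refuted (⊤' ⇒ ⊤') ρ₀ (λ _ _ t → t))

uniform-simplification : (S : TSet) (n : NegN) →
  (∀ σ t → S σ ≡ just t → Valid σ t × N t ≡ n) → Simplification S
uniform-simplification S n entry =
  (λ σ t e → proj₁ (entry σ t e)) ,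
  (λ σ τ t u e e' → ≡-trans (proj₂ (entry σ t e)) (sym (proj₂ (entry τ u e'))))

-- If some entry of S uses n, any simplification
-- extending S uses n on every symbol; so S is not properly included in another
-- simplification as soon as no symbol missing from S has a valid
-- transformation with this n.
ClosedUnderExtension : TSet → Set
ClosedUnderExtension S = (S' : TSet) → Simplification S' → S ⊆T S' → S' ⊆T S

closed-under-extension : (S : TSet) (n : NegN) {τ : Sym} {u : Trans τ} →
  S τ ≡ just u → N u ≡ n →
  (∀ σ (t : Trans σ) → S σ ≡ nothing → N t ≡ n → ¬ Valid σ t) →
  ClosedUnderExtension S
closed-under-extension S n {τ} {u} Sτ Nu≡n impossible S' (valid , sameN) S⊆S' σ t S'σ
  with S σ in Sσ
... | just t' = cong just (just-injective (≡-trans (sym (S⊆S' σ t' Sσ)) S'σ))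
... | nothing = ⊥-elim (impossible σ t Sσ Nt≡n (valid σ t S'σ))
  where
  Nt≡n : N t ≡ n
  Nt≡n = ≡-trans (sameN σ τ t u S'σ (S⊆S' τ u Sτ)) Nu≡n

RightSidesMinimal : TSet → Set
RightSidesMinimal S =
  (σ : Sym) (t : Trans σ) → S σ ≡ just t → (r : Rhs σ) →
  Simplification (update S σ (just (trans (N t) r))) →
  ¬ (rhsCount σ (N t) r < rhsCount σ (N t) (rhs t))

rhsCount-lower-bound : (σ : Sym) (n : NegN) (r : Rhs σ) → #N n ≤ rhsCount σ n r
rhsCount-lower-bound (con _) n (_ , n₁ , n₂) = ≤-trans (m≤m+n (#N n) n₁) (m≤m+n (#N n + n₁) n₂)
rhsCount-lower-bound (qu _)  n (_ , n₁)      = m≤m+n (#N n) n₁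

least-rhsCount : (σ : Sym) (n : NegN) (r r' : Rhs σ) →
  rhsCount σ n r ≡ #N n → ¬ (rhsCount σ n r' < rhsCount σ n r)
least-rhsCount σ n r r' least shorter =
  ≤⇒≯ (rhsCount-lower-bound σ n r') (subst (rhsCount σ n r' <_) least shorter)

update-here : (S : TSet) (σ : Sym) (m : Maybe (Trans σ)) → update S σ m σ ≡ m
update-here S σ m with σ ≟S σ
... | yes refl = refl
... | no σ≢σ   = ⊥-elim (σ≢σ refl)

r₁-entries : ∀ σ t → r₁ σ ≡ just t → Valid σ t × N t ≡ double
r₁-entries (con cand) _ refl = (r₁-∧ , <ᵇ⇒< 2 6 tt) , refl
r₁-entries (con cor)  _ refl = (r₁-∨ , <ᵇ⇒< 2 6 tt) , refl
r₁-entries (con cimp) _ refl = (r₁-⇒ , <ᵇ⇒< 2 6 tt) , refl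
r₁-entries (qu qex)   _ refl = (r₁-∃ , <ᵇ⇒< 2 4 tt) , refl

r₁-missing : ∀ σ (t : Trans σ) → r₁ σ ≡ nothing → N t ≡ double → ¬ Valid σ t
r₁-missing (con cand) _ ()
r₁-missing (con cor)  _ ()
r₁-missing (con cimp) _ ()
r₁-missing (qu qex)   _ ()
r₁-missing (qu qall)  t _ = no-double-∀ t

-- every right side of r₁ is a bare ¬¬, which cannot be shortened
r₁-minimal : RightSidesMinimal r₁
r₁-minimal (con cand) _ refl r _ = least-rhsCount (con cand) double (cand , 0 , 0) r refl
r₁-minimal (con cor)  _ refl r _ = least-rhsCount (con cor) double (cor , 0 , 0) r refl
r₁-minimal (con cimp) _ refl r _ = least-rhsCount (con cimp) double (cimp , 0 , 0) r refl
r₁-minimal (qu qex)   _ refl r _ = least-rhsCount (qu qex) double (qex , 0) r refl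

maximal-r₁ : Maximal r₁
maximal-r₁ =
  uniform-simplification r₁ double r₁-entries ,
  closed-under-extension r₁ double {con cand} refl refl r₁-missing ,
  r₁-minimal

r₂-entries : ∀ σ t → r₂ σ ≡ just t → Valid σ t × N t ≡ single
r₂-entries (con cand) _ refl = (r₂-∧ , <ᵇ⇒< 1 4 tt) , refl
r₂-entries (con cor)  _ refl = (r₂-∨ , <ᵇ⇒< 1 4 tt) , refl
r₂-entries (con cimp) _ refl = (r₂-⇒ , <ᵇ⇒< 2 4 tt) , refl
r₂-entries (qu qall)  _ refl = (r₂-∀ , <ᵇ⇒< 1 3 tt) , refl

r₂-missing : ∀ σ (t : Trans σ) → r₂ σ ≡ nothing → N t ≡ single → ¬ Valid σ t
r₂-missing (con cand) _ ()
r₂-missing (con cor)  _ ()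
r₂-missing (con cimp) _ ()
r₂-missing (qu qall)  _ ()
r₂-missing (qu qex)   t _ = no-single-∃ t

-- the right sides of r₂ are bare ¬ except ¬(¬A ∧ B), whose only shorter
-- candidates ¬(A □ B) are invalid
r₂-minimal : RightSidesMinimal r₂
r₂-minimal (con cand) _ refl r _ = least-rhsCount (con cand) single (cor , 0 , 0) r refl
r₂-minimal (con cor)  _ refl r _ = least-rhsCount (con cor) single (cand , 0 , 0) r refl
r₂-minimal (qu qall)  _ refl r _ = least-rhsCount (qu qall) single (qex , 0) r refl
r₂-minimal (con cimp) _ refl (c , 0 , 0) (valid , _) _ =
  no-short-⇒ c (valid (con cimp) _ (update-here r₂ (con cimp) _))
r₂-minimal (con cimp) _ refl (c , 0 , suc _) _ (s≤s (s≤s ()))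
r₂-minimal (con cimp) _ refl (c , suc _ , _) _ (s≤s (s≤s ()))

maximal-r₂ : Maximal r₂
maximal-r₂ =
  uniform-simplification r₂ single r₂-entries ,
  closed-under-extension r₂ single {con cand} refl refl r₂-missing ,
  r₂-minimal

proposition6 : Maximal r₁ × Maximal r₂
proposition6 = maximal-r₁ , maximal-r₂
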